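{- With the inherited virtual spanning forests chosen as described in the context, for every arrival $t\ge1$ and every level $i\ge0$ we have $\mathscr{C}^{(t-1)}_{i+1}\preceq\mathscr{C}^{(t)}_{\mathrm{inh},i}$.
   Context: Setting: $\mathcal{M}$ is a metric on terminals with all distances at least $1$; each terminal lies in exactly one demand pair; $(\mathcal{M}^{(t)},D^{(t)})$ consists of the first $t$ demand pairs and the submetric on the arrived terminals. A clustering is a partition; $\mathscr{C}_1\preceq\mathscr{C}_2$ means every cluster of $\mathscr{C}_1$ is contained in some cluster of $\mathscr{C}_2$. $\mathcal{M}/\mathscr{C}$ is the shortest-path metric on $\mathscr{C}$ of the complete graph on the terminals (edge costs = distances) with each cluster contracted to a vertex. Clustering procedure on $(\mathcal{M},D)$: $\mathrm{level}(v)=\lceil\log_2\mathrm{dist}_{\mathcal{M}}(v,\text{mate of }v)\rceil$, $\mathrm{level}(C)=\max_{v\in C}\mathrm{level}(v)$, $L=\max_v\mathrm{level}(v)$; $\mathscr{C}_0$ is the singleton partition; for $i=0,\dots,L$, the virtual graph $H_i$ has as vertices the clusters $C\in\mathscr{C}_i$ with $\mathrm{level}(C)\ge i$ ($i$-active) and an edge $C_1C_2$ iff $\mathrm{dist}_{\mathcal{M}/\mathscr{C}_i}(C_1,C_2)<2^{i+1}$; $\mathscr{C}_{i+1}$ keeps the non-$i$-active clusters and replaces each connected component of $H_i$ by the union of its clusters. Superscript $(t)$ refers to $(\mathcal{M}^{(t)},D^{(t)})$; for $i\ge L^{(t)}+1$, $\mathscr{C}^{(t)}_i=\mathscr{C}^{(t)}_{L^{(t)}+1}$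 and $H^{(t)}_i$ is empty; for $t=0$ everything is empty. One has $\mathscr{C}^{(t-1)}_i\preceq\mathscr{C}^{(t)}_i$. Contracting a set $\hat F$ of edges of $H^{(t)}_i$ over $\mathscr{C}^{(t)}_i$ means: keep the non-$i$-active clusters, and replace the clusters in each connected component of the graph $(V(H^{(t)}_i),\hat F)$ by their union. Virtual forests: for each $t$ and $i$ a spanning forest $\hat F^{(t)}_i$ of $H^{(t)}_i$ is chosen as follows. An edge $(C_1,C_2)\in\hat F^{(t-1)}_i$ is inheritable if $C_1,C_2$ lie in different clusters $D_1,D_2$ of $\mathscr{C}^{(t)}_i$; in that case $H^{(t)}_i$ contains an edge $D_1D_2$, which is its image. The inherited edges of $H^{(t)}_i$ are the images of the inheritable edges of $\hat F^{(t-1)}_i$. Let $\hat F^{(t)}_{\mathrm{inh},i}$ be an arbitrary spanning forest of the subgraph of $H^{(t)}_i$ formed by the inherited edges, and let $\hat F^{(t)}_i\supseteq\hat F^{(t)}_{\mathrm{inh},i}$ be an arbitrary extension to a spanning forest of $H^{(t)}_i$. Define $\mathscr{C}^{(t)}_{\mathrm{inh},i}$ as the clustering obtained by contracting $\hat F^{(t)}_{\mathrm{inh},i}$ over $\mathscr{C}^{(t)}_i$.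
   Formalization: The distances of the metric $\mathcal{M}$ take values in the rationals. -}

module Defs where

open import Data.Nat using (ℕ; zero; suc; _^_) renaming (_<_ to _<ℕ_; _≤_ to _≤ℕ_)
open import Data.Integer using (+_)
open import Data.Rational using (ℚ; _/_; 0ℚ; 1ℚ; _+_; _≤_; _<_)
open import Data.Fin using (Fin; toℕ)
open import Data.Bool using (Bool; not)
open import Data.Product using (Σ; ∃; ∃₂; _×_; _,_; proj₁; proj₂)
open import Data.Sum using (_⊎_)
open import Data.List using (List; _∷_; _++_)
open import Data.List.Membership.Propositional using (_∈_)
open import Relation.Binary.PropositionalEquality using (_≡_; _≢_)
open import Relation.Binary.Construct.Closure.ReflexiveTransitive using (Star)
open import Relation.Nullary using (¬_)

-- Terminals of an instance with k demand pairs: terminal (p , b) is side b of pair p.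
-- Each terminal lies in exactly one demand pair; its mate is the other side.
-- Pairs arrive in the order of their index: the t-th arrival is pair t-1.
Term : ℕ → Set
Term k = Fin k × Bool

mate : ∀ {k} → Term k → Term k
mate (p , b) = (p , not b)

pow2 : ℕ → ℚ
pow2 m = + (2 ^ m) / 1

record IsMetric (k : ℕ) (d : Term k → Term k → ℚ) : Set where
  field
    dist-refl : ∀ x → d x x ≡ 0ℚ
    dist-sym  : ∀ x y → d x y ≡ d y x
    dist-tri  : ∀ x y z → d x z ≤ d x y + d y z
    dist-≥1   : ∀ x y → x ≢ y → 1ℚ ≤ d x y

module Instance (k : ℕ) (d : Term k → Term k → ℚ) where

  T : Set
  T = Term k

  Edge : Set
  Edge = T × T

  Arr : ℕ → T → Set
  Arr t x = toℕ (proj₁ x) <ℕ t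

  -- level(x) = m  iff  m = ⌈log₂ dist(x, mate x)⌉, i.e. m is the least
  -- natural number with dist(x, mate x) ≤ 2^m.
  IsLevel : T → ℕ → Set
  IsLevel x m = (d x (mate x) ≤ pow2 m) × (∀ m′ → d x (mate x) ≤ pow2 m′ → m ≤ℕ m′)

  -- A clustering is represented by its "same cluster" relation R
  -- (R x y: x and y are arrived terminals lying in the same cluster).

  -- Walks in the complete graph on the (arrived) terminals with every cluster
  -- contracted, from the cluster of x to the cluster of y, of total cost c.
  data Walk (R : T → T → Set) : T → T → ℚ → Set where
    stop : ∀ {x y} → R x y → Walk R x y 0ℚ
    hop  : ∀ {x x′ z y c} → R x x′ → Walk R z y c → Walk R x y (d x′ z + c)

  -- dist_{M/𝒞}(cluster x, cluster y) < r   (the shortest-path distance is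
  -- below r iff some walk has cost below r)
  DistLt : (T → T → Set) → T → T → ℚ → Set
  DistLt R x y r = ∃ λ c → Walk R x y c × c < r

  Active : (T → T → Set) → ℕ → T → Set
  Active R i x = ∃₂ λ w m → R x w × IsLevel w m × i ≤ℕ m

  -- adjacency in the virtual graph H_i (on cluster representatives;
  -- a pair in the same active cluster counts as trivially adjacent)
  Adj : (T → T → Set) → ℕ → T → T → Set
  Adj R i x y = Active R i x × Active R i y × DistLt R x y (pow2 (suc i))

  -- an edge C₁C₂ of H_i, represented by terminals x ∈ C₁, y ∈ C₂ (C₁ ≠ C₂)
  HEdge : (T → T → Set) → ℕ → Edge → Set
  HEdge R i (x , y) = Active R i x × Active R i y × DistLt R x y (pow2 (suc i)) × ¬ R x y

  Next : (T → T → Set) → ℕ → T → T → Set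
  Next R i x y = R x y ⊎ (Active R i x × Active R i y × Star (Adj R i) x y)

  -- Same t i x y : x and y lie in the same cluster of 𝒞^{(t)}_i
  Same : ℕ → ℕ → T → T → Set
  Same t zero    x y = Arr t x × x ≡ y
  Same t (suc i) x y = Next (Same t i) i x y

  -- connectivity (at cluster level) in the graph whose vertices are the
  -- clusters of R and whose edge set is E (edges given by representatives)
  ConnE : (T → T → Set) → (Edge → Set) → T → T → Set
  ConnE R E = Star (λ a b → R a b ⊎ E (a , b) ⊎ E (b , a))

  ConnF : (T → T → Set) → List Edge → T → T → Set
  ConnF R Fs = ConnE R (λ e → e ∈ Fs)

  -- two representative pairs describe the same (undirected) cluster edge
  SameEdge : (T → T → Set) → Edge → Edge → Set
  SameEdge R (a , b) (a′ , b′) = (R a a′ × R b b′) ⊎ (R a b′ × R b a′)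

  record IsSpanningForest (R : T → T → Set) (i : ℕ) (E : Edge → Set) (Fs : List Edge) : Set where
    field
      edges    : ∀ e → e ∈ Fs → E e
      spanning : ∀ x y → Active R i x → Active R i y → ConnE R E x y → ConnF R Fs x y
      acyclic  : ∀ pre e post → Fs ≡ pre ++ e ∷ post →
                 ¬ ConnF R (pre ++ post) (proj₁ e) (proj₂ e)

  -- inherited edges of H^{(t)}_i: images of the inheritable edges of the
  -- forest Fprev = F̂^{(t-1)}_i (image of (a,b) is represented by (a,b) again)
  InhEdge : ℕ → ℕ → List Edge → Edge → Set
  InhEdge t i Fprev e =
    ∃ λ e′ → e′ ∈ Fprev × ¬ Same t i (proj₁ e′) (proj₂ e′) × SameEdge (Same t i) e e′

  Contract : (T → T → Set) → ℕ → List Edge → T → T → Set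
  Contract R i Fs x y = R x y ⊎ (Active R i x × Active R i y × ConnF R Fs x y)

open Instance public

{-# OPTIONS --safe #-}
module Submission where

-- A cluster of 𝒞^{(t-1)}_{i+1} is either a cluster of 𝒞^{(t-1)}_i, hence inside a cluster of
-- 𝒞^{(t)}_i, or a connected component of H^{(t-1)}_i. Each edge of H^{(t-1)}_i joins two clusters
-- that either merge in 𝒞^{(t)}_i or are connected in the forest F̂^{(t-1)}_i, and each edge of that
-- forest either lies inside a cluster of 𝒞^{(t)}_i or is inheritable. So every such component is
-- connected by inherited edges, hence by their spanning forest F̂^{(t)}_{inh,i}.
-- These case distinctions need cluster membership to be decidable: there are finitely many
-- terminals, and as distances between distinct terminals are at least 1, a walk of cost below
-- 2^{i+1} can be shortened to one with fewer than 2^{i+1} hops.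

open import Data.Bool using (true; false)
import Data.Bool.Properties as Bool
open import Data.Empty using (⊥; ⊥-elim)
open import Data.Fin using (toℕ)
import Data.Fin.Properties as Fin
open import Data.Integer as ℤ using (+_; -[1+_]; +≤+; -≤+; +<+)
import Data.Integer.Properties as ℤ
open import Data.List using (List; []; _∷_; _++_; length; allFin; cartesianProduct)
import Data.List.Properties as List
open import Data.List.Membership.Propositional using (_∈_; lose)
open import Data.List.Membership.Propositional.Properties
  using (∈-∃++; ∈-++⁻; ∈-++⁺ˡ; ∈-++⁺ʳ; ∈-allFin; ∈-cartesianProduct⁺)
open import Data.List.Relation.Binary.Subset.Propositional using (_⊆_)
open import Data.List.Relation.Unary.All using (lookup)
open import Data.List.Relation.Unary.All.Properties using (¬Any⇒All¬)
open import Data.List.Relation.Unary.Any using (here; there; any?; satisfied)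
open import Data.List.Relation.Unary.Unique.Propositional using (Unique; []; _∷_)
open import Data.Nat using (ℕ; zero; suc; _^_; _≤_; _<_; z≤n; s≤s; _≤?_; _<?_)
import Data.Nat.Properties as ℕ
import Data.Nat.Coprimality as Coprime
open import Data.Product using (Σ-syntax; ∃; ∃₂; _×_; _,_; proj₁; proj₂)
open import Data.Product.Properties using (≡-dec)
open import Data.Rational as ℚ using (ℚ; mkℚ; _/_; 0ℚ; 1ℚ; _+_; *≤*; *<*)
import Data.Rational.Properties as ℚ
open import Data.Sum using (_⊎_; inj₁; inj₂)
open import Level using (0ℓ)
open import Relation.Binary
  using (Rel; _⇒_; Decidable; DecidableEquality; Symmetric; Transitive; IsPartialEquivalence)
import Relation.Binary.Construct.Closure.ReflexiveTransitive as Star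
open Star using (Star; ε; _◅_; _◅◅_; _⋆; return; reverse)
open import Relation.Binary.PropositionalEquality
  using (_≡_; refl; sym; trans; cong; subst; subst₂; module ≡-Reasoning)
open import Relation.Nullary using (Dec; yes; no; map′)
open import Relation.Nullary.Decidable using (_×-dec_; _⊎-dec_)

open import Defs using (Term; mate; pow2; IsMetric; module Instance)

unique⇒length≤ : {A : Set} {xs ys : List A} → Unique xs → xs ⊆ ys → length xs ≤ length ys
unique⇒length≤ [] _ = z≤n
unique⇒length≤ {xs = x ∷ xs} (x∉xs ∷ xs!) xs⊆ys with ∈-∃++ (xs⊆ys (here refl))
... | as , bs , refl = subst (suc (length xs) ≤_) (sym (List.length-++-sucʳ as x bs))
                             (s≤s (unique⇒length≤ xs! xs⊆as++bs))
  where
  xs⊆as++bs : xs ⊆ as ++ bs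
  xs⊆as++bs z∈xs with ∈-++⁻ as (xs⊆ys (there z∈xs))
  ... | inj₁ z∈as         = ∈-++⁺ˡ z∈as
  ... | inj₂ (here refl)  = ⊥-elim (lookup x∉xs z∈xs refl)
  ... | inj₂ (there z∈bs) = ∈-++⁺ʳ as z∈bs

module FiniteSearch {A : Set} (_≟_ : DecidableEquality A)
                    (elems : List A) (complete : ∀ x → x ∈ elems) where

  open import Data.List.Membership.DecPropositional _≟_ using (_∈?_)

  ∃? : {P : A → Set} → (∀ x → Dec (P x)) → Dec (∃ P)
  ∃? P? = map′ satisfied (λ (x , px) → lose (complete x) px) (any? P? elems)

  module _ {E : Rel A 0ℓ} (E? : Decidable E) where

    sources : ∀ {x y} → Star E x y → List A
    sources ε = []
    sources {x} (_ ◅ p) = x ∷ sources p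

    suffixFrom : ∀ {x v y} (p : Star E v y) → x ∈ sources p → Unique (sources p) →
                 ∃ λ (q : Star E x y) → Unique (sources q)
    suffixFrom (e ◅ p) (here refl) p! = e ◅ p , p!
    suffixFrom (_ ◅ p) (there x∈p) (_ ∷ p!) = suffixFrom p x∈p p!

    removeCycles : ∀ {x y} → Star E x y → ∃ λ (q : Star E x y) → Unique (sources q)
    removeCycles ε = ε , []
    removeCycles {x} (e ◅ p) with removeCycles p
    ... | q , q! with x ∈? sources q
    ...   | yes x∈q = suffixFrom q x∈q q!
    ...   | no x∉q = e ◅ q , ¬Any⇒All¬ (sources q) x∉q ∷ q!

    Within : ℕ → A → A → Set
    Within zero    x y = x ≡ y
    Within (suc n) x y = x ≡ y ⊎ ∃ λ z → E x z × Within n z y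

    within? : ∀ n → Decidable (Within n)
    within? zero    x y = x ≟ y
    within? (suc n) x y = x ≟ y ⊎-dec ∃? (λ z → E? x z ×-dec within? n z y)

    within⇒star : ∀ n {x y} → Within n x y → Star E x y
    within⇒star zero    refl = ε
    within⇒star (suc n) (inj₁ refl) = ε
    within⇒star (suc n) (inj₂ (_ , e , w)) = e ◅ within⇒star n w

    star⇒within : ∀ {n x y} (p : Star E x y) → length (sources p) ≤ n → Within n x y
    star⇒within {zero}  ε _ = refl
    star⇒within {suc n} ε _ = inj₁ refl
    star⇒within (e ◅ p) (s≤s p≤n) = inj₂ (_ , e , star⇒within p p≤n)

    star? : Decidable (Star E)
    star? x y = map′ (within⇒star (length elems)) star⇒within-size
                     (within? (length elems) x y)
      where
      star⇒within-size : Star E x y → Within (length elems) x y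
      star⇒within-size p with removeCycles p
      ... | q , q! = star⇒within q (unique⇒length≤ q! (λ {z} _ → complete z))

fromℕ : ℕ → ℚ
fromℕ n = + n / 1

fromℕ≡mkℚ : ∀ n → fromℕ n ≡ mkℚ (+ n) 0 (Coprime.sym (Coprime.1-coprimeTo n))
fromℕ≡mkℚ n = ℚ.normalize-coprime (Coprime.sym (Coprime.1-coprimeTo n))

fromℕ-suc : ∀ n → fromℕ (suc n) ≡ 1ℚ + fromℕ n
fromℕ-suc n rewrite fromℕ≡mkℚ n =
  cong (_/ 1) (cong (λ m → + 1 ℤ.+ m) (sym (ℤ.*-identityʳ (+ n))))

fromℕ-mono-≤ : ∀ {m n} → m ≤ n → fromℕ m ℚ.≤ fromℕ n
fromℕ-mono-≤ {m} {n} m≤n rewrite fromℕ≡mkℚ m | fromℕ≡mkℚ n =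
  *≤* (subst₂ ℤ._≤_ (sym (ℤ.*-identityʳ (+ m))) (sym (ℤ.*-identityʳ (+ n))) (+≤+ m≤n))

fromℕ-mono-< : ∀ {m n} → m < n → fromℕ m ℚ.< fromℕ n
fromℕ-mono-< {m} {n} m<n rewrite fromℕ≡mkℚ m | fromℕ≡mkℚ n =
  *<* (subst₂ ℤ._<_ (sym (ℤ.*-identityʳ (+ m))) (sym (ℤ.*-identityʳ (+ n))) (+<+ m<n))

fromℕ-cancel-< : ∀ {m n} → fromℕ m ℚ.< fromℕ n → m < n
fromℕ-cancel-< {m} {n} m<n rewrite fromℕ≡mkℚ m | fromℕ≡mkℚ n =
  ℤ.drop‿+<+ (subst₂ ℤ._<_ (ℤ.*-identityʳ (+ m)) (ℤ.*-identityʳ (+ n)) (ℚ.drop-*<* m<n))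

n<2^n : ∀ n → n < 2 ^ n
n<2^n zero = s≤s z≤n
n<2^n (suc n) = ℕ.+-mono-≤ (ℕ.m^n>0 2 n) (ℕ.≤-trans (n<2^n n) (ℕ.m≤m+n (2 ^ n) 0))

pow2-positive : ∀ m → 0ℚ ℚ.< pow2 m
pow2-positive m = fromℕ-mono-< (ℕ.m^n>0 2 m)

pow2-mono-≤ : ∀ {m n} → m ≤ n → pow2 m ℚ.≤ pow2 n
pow2-mono-≤ m≤n = fromℕ-mono-≤ (ℕ.^-monoʳ-≤ 2 m≤n)

pow2-unbounded : ∀ q → ∃ λ m → q ℚ.≤ pow2 m
pow2-unbounded q@(mkℚ -[1+ _ ] _ _) = 0 , subst (q ℚ.≤_) (sym (fromℕ≡mkℚ 1)) (*≤* -≤+)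
pow2-unbounded q@(mkℚ (+ n) den-1 _) =
  n , subst (q ℚ.≤_) (sym (fromℕ≡mkℚ (2 ^ n))) (*≤* n≤2^n*den)
  where
  n≤2^n*den : + n ℤ.* + 1 ℤ.≤ + (2 ^ n) ℤ.* + suc den-1
  n≤2^n*den rewrite ℤ.*-identityʳ (+ n) | sym (ℤ.pos-* (2 ^ n) (suc den-1)) =
    +≤+ (ℕ.≤-trans (ℕ.<⇒≤ (n<2^n n)) (ℕ.m≤m*n (2 ^ n) (suc den-1)))

IsCeilLog₂ : ℚ → ℕ → Set
IsCeilLog₂ q m = q ℚ.≤ pow2 m × (∀ m′ → q ℚ.≤ pow2 m′ → m ≤ m′)

ceilLog₂-unique : ∀ {q m n} → IsCeilLog₂ q m → IsCeilLog₂ q n → m ≡ n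
ceilLog₂-unique (q≤2^m , m-least) (q≤2^n , n-least) =
  ℕ.≤-antisym (m-least _ q≤2^n) (n-least _ q≤2^m)

ceilLog₂ : ∀ q → ∃ (IsCeilLog₂ q)
ceilLog₂ q = leastBelow (proj₁ (pow2-unbounded q)) (proj₂ (pow2-unbounded q))
  where
  leastBelow : ∀ M → q ℚ.≤ pow2 M → ∃ (IsCeilLog₂ q)
  leastBelow zero    q≤2^M = 0 , q≤2^M , λ _ _ → z≤n
  leastBelow (suc M) q≤2^M with q ℚ.≤? pow2 M
  ... | yes q≤2^M-1 = leastBelow M q≤2^M-1
  ... | no  q≰2^M-1 = suc M , q≤2^M , λ m q≤2^m →
          ℕ.≰⇒> (λ m≤M-1 → q≰2^M-1 (ℚ.≤-trans q≤2^m (pow2-mono-≤ m≤M-1)))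

module Clustering (k : ℕ) (d : Term k → Term k → ℚ) where

  open Instance k d

  _≟ᵀ_ : DecidableEquality T
  _≟ᵀ_ = ≡-dec Fin._≟_ Bool._≟_

  terminals : List T
  terminals = cartesianProduct (allFin k) (true ∷ false ∷ [])

  ∈-terminals : ∀ x → x ∈ terminals
  ∈-terminals (p , true)  = ∈-cartesianProduct⁺ (∈-allFin p) (here refl)
  ∈-terminals (p , false) = ∈-cartesianProduct⁺ (∈-allFin p) (there (here refl))

  open FiniteSearch _≟ᵀ_ terminals ∈-terminals

  level : T → ℕ
  level x = proj₁ (ceilLog₂ (d x (mate x)))

  level-isLevel : ∀ x → IsLevel x (level x)
  level-isLevel x = proj₂ (ceilLog₂ (d x (mate x)))

  module _ {R R′ : Rel T 0ℓ} (R⊆R′ : R ⇒ R′) where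

    walk-mono : ∀ {x y c} → Walk R x y c → Walk R′ x y c
    walk-mono (stop r)  = stop (R⊆R′ r)
    walk-mono (hop r w) = hop (R⊆R′ r) (walk-mono w)

    active-mono : ∀ {i x} → Active R i x → Active R′ i x
    active-mono (w , m , r , isLevel , i≤m) = w , m , R⊆R′ r , isLevel , i≤m

    adj-mono : ∀ {i} → Adj R i ⇒ Adj R′ i
    adj-mono (ax , ay , c , w , c<) = active-mono ax , active-mono ay , c , walk-mono w , c<

    next-mono : ∀ {i} → Next R i ⇒ Next R′ i
    next-mono (inj₁ r) = inj₁ (R⊆R′ r)
    next-mono (inj₂ (ax , ay , p)) = inj₂ (active-mono ax , active-mono ay , Star.map adj-mono p)

  module _ {R : Rel T 0ℓ} where

    _++ᵂ_ : ∀ {x a b y c₁ c₂} → Walk R x a c₁ → Walk R b y c₂ → Walk R x y (c₁ + (d a b + c₂))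
    stop r ++ᵂ w = subst (Walk R _ _) (sym (ℚ.+-identityˡ _)) (hop r w)
    hop {x′ = x′} {z = z} {c = c} r w₁ ++ᵂ w₂ =
      subst (Walk R _ _) (sym (ℚ.+-assoc (d x′ z) c _)) (hop r (w₁ ++ᵂ w₂))

    hops : ∀ {x y c} → Walk R x y c → ℕ
    hops (stop _)  = 0
    hops (hop _ w) = suc (hops w)

    active-resp : Transitive R → ∀ {i x y} → R x y → Active R i y → Active R i x
    active-resp R-trans rxy (w , m , ryw , isLevel , i≤m) =
      w , m , R-trans rxy ryw , isLevel , i≤m

    adj-inCluster : ∀ {i x y} → R x y → Active R i x → Active R i y → Adj R i x y
    adj-inCluster {i} rxy ax ay = ax , ay , 0ℚ , stop rxy , pow2-positive (suc i)

  same-arrived : ∀ {t} i {x y} → Same t i x y → Arr t x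
  same-arrived zero    (arrived , _) = arrived
  same-arrived (suc i) (inj₁ r) = same-arrived i r
  same-arrived (suc i) (inj₂ ((_ , _ , r , _) , _)) = same-arrived i r

  same-refl : ∀ {t} i {x} → Arr t x → Same t i x x
  same-refl zero    arrived = arrived , refl
  same-refl (suc i) arrived = inj₁ (same-refl i arrived)

  same-mono : ∀ {t} i → Same t i ⇒ Same (suc t) i
  same-mono zero    (arrived , x≡y) = ℕ.m<n⇒m<1+n arrived , x≡y
  same-mono (suc i) r = next-mono (same-mono i) r

  connE-sym : ∀ {R E} → Symmetric R → Symmetric (ConnE R E)
  connE-sym {R} {E} R-sym = reverse step-sym
    where
    step-sym : ∀ {a b} → R a b ⊎ E (a , b) ⊎ E (b , a) → R b a ⊎ E (b , a) ⊎ E (a , b)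
    step-sym (inj₁ r)        = inj₁ (R-sym r)
    step-sym (inj₂ (inj₁ e)) = inj₂ (inj₂ e)
    step-sym (inj₂ (inj₂ e)) = inj₂ (inj₁ e)

  module _ (metric : IsMetric k d) where

    open IsMetric metric

    walk-reverse : ∀ {R} → Symmetric R → ∀ {x y c} → Walk R x y c → Walk R y x c
    walk-reverse R-sym (stop r) = stop (R-sym r)
    walk-reverse {R} R-sym (hop {x′ = x′} {z = z} {c = c} r w) =
      subst (Walk R _ _) cost (walk-reverse R-sym w ++ᵂ stop (R-sym r))
      where
      open ≡-Reasoning
      cost : c + (d z x′ + 0ℚ) ≡ d x′ z + c
      cost = begin
        c + (d z x′ + 0ℚ) ≡⟨ cong (_+_ c) (ℚ.+-identityʳ (d z x′)) ⟩
        c + d z x′        ≡⟨ cong (_+_ c) (dist-sym z x′) ⟩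
        c + d x′ z        ≡⟨ ℚ.+-comm c (d x′ z) ⟩
        d x′ z + c        ∎

    next-isPER : ∀ {R} → IsPartialEquivalence R → ∀ i → IsPartialEquivalence (Next R i)
    next-isPER {R} R-isPER i = record { sym = next-sym ; trans = next-trans }
      where
      open IsPartialEquivalence R-isPER renaming (sym to R-sym; trans to R-trans)

      adj-sym : Symmetric (Adj R i)
      adj-sym (ax , ay , c , w , c<) = ay , ax , c , walk-reverse R-sym w , c<

      next-sym : Symmetric (Next R i)
      next-sym (inj₁ r) = inj₁ (R-sym r)
      next-sym (inj₂ (ax , ay , p)) = inj₂ (ay , ax , reverse adj-sym p)

      next-trans : Transitive (Next R i)
      next-trans (inj₁ rxy) (inj₁ ryz) = inj₁ (R-trans rxy ryz)
      next-trans (inj₁ rxy) (inj₂ (ay , az , p)) =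
        let ax = active-resp R-trans rxy ay in inj₂ (ax , az , adj-inCluster rxy ax ay ◅ p)
      next-trans (inj₂ (ax , ay , p)) (inj₁ ryz) =
        let az = active-resp R-trans (R-sym ryz) ay
        in  inj₂ (ax , az , p ◅◅ return (adj-inCluster ryz ay az))
      next-trans (inj₂ (ax , _ , p)) (inj₂ (_ , az , q)) = inj₂ (ax , az , p ◅◅ q)

    module _ {R : Rel T 0ℓ} (R? : Decidable R) (R-trans : Transitive R) where

      prepend : ∀ {x x′ y c} → R x x′ → Walk R x′ y c → Walk R x y c
      prepend r (stop r′)   = stop (R-trans r r′)
      prepend r (hop r′ w) = hop (R-trans r r′) w

      hops-prepend : ∀ {x x′ y c} (r : R x x′) (w : Walk R x′ y c) →
                     hops (prepend r w) ≡ hops w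
      hops-prepend _ (stop _)  = refl
      hops-prepend _ (hop _ _) = refl

      -- Hops inside one terminal cost nothing and are absorbed into the cluster relation;
      -- every other hop costs at least 1.
      shortcut : ∀ {x y c} → Walk R x y c →
                 ∃ λ c′ → Σ[ w ∈ Walk R x y c′ ] c′ ℚ.≤ c × fromℕ (hops w) ℚ.≤ c′
      shortcut (stop r) = 0ℚ , stop r , ℚ.≤-refl , ℚ.≤-refl
      shortcut (hop {x′ = x′} {z = z} {c = c} r w) with shortcut w | x′ ≟ᵀ z
      ... | c′ , w′ , c′≤c , hops≤c′ | yes refl =
        c′ , prepend r w′ , subst (c′ ℚ.≤_) free-hop c′≤c ,
        subst (λ h → fromℕ h ℚ.≤ c′) (sym (hops-prepend r w′)) hops≤c′
        where
        free-hop : c ≡ d x′ x′ + c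
        free-hop = sym (trans (cong (_+ c) (dist-refl x′)) (ℚ.+-identityˡ c))
      ... | c′ , w′ , c′≤c , hops≤c′ | no x′≢z =
        d x′ z + c′ , hop r w′ , ℚ.+-monoʳ-≤ (d x′ z) c′≤c ,
        subst (ℚ._≤ d x′ z + c′) (sym (fromℕ-suc (hops w′)))
              (ℚ.+-mono-≤ (dist-≥1 x′ z x′≢z) hops≤c′)

      module _ (r : ℚ) where

        CheapWithin : ℕ → ℚ → T → T → Set
        CheapWithin zero    s x y = ⊥
        CheapWithin (suc n) s x y =
          (R x y × s ℚ.< r) ⊎ ∃₂ λ x′ z → R x x′ × CheapWithin n (s + d x′ z) z y

        cheapWithin? : ∀ n s x y → Dec (CheapWithin n s x y)
        cheapWithin? zero    s x y = no λ ()
        cheapWithin? (suc n) s x y = (R? x y ×-dec (s ℚ.<? r)) ⊎-dec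
          ∃? (λ x′ → ∃? λ z → R? x x′ ×-dec cheapWithin? n (s + d x′ z) z y)

        cheapWithin⇒walk : ∀ n {s x y} → CheapWithin n s x y →
                           ∃ λ c → Walk R x y c × s + c ℚ.< r
        cheapWithin⇒walk (suc n) (inj₁ (rxy , s<r)) =
          0ℚ , stop rxy , subst (ℚ._< r) (sym (ℚ.+-identityʳ _)) s<r
        cheapWithin⇒walk (suc n) {s} (inj₂ (x′ , z , rxx′ , cheap)) with cheapWithin⇒walk n cheap
        ... | c , w , s+δ+c<r =
          d x′ z + c , hop rxx′ w , subst (ℚ._< r) (ℚ.+-assoc s (d x′ z) c) s+δ+c<r

        walk⇒cheapWithin : ∀ {n s x y c} (w : Walk R x y c) → hops w < n → s + c ℚ.< r →
                           CheapWithin n s x y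
        walk⇒cheapWithin {suc n} (stop rxy) _ s+0<r =
          inj₁ (rxy , subst (ℚ._< r) (ℚ.+-identityʳ _) s+0<r)
        walk⇒cheapWithin {s = s} (hop {x′ = x′} {z = z} {c = c} rxx′ w) (s≤s hops<n) s+c<r =
          inj₂ (x′ , z , rxx′ , walk⇒cheapWithin w hops<n s+δ+c<r)
          where
          s+δ+c<r : s + d x′ z + c ℚ.< r
          s+δ+c<r = subst (ℚ._< r) (sym (ℚ.+-assoc s (d x′ z) c)) s+c<r

      distLt? : ∀ N x y → Dec (DistLt R x y (fromℕ N))
      distLt? N x y = map′ sound complete (cheapWithin? (fromℕ N) N 0ℚ x y)
        where
        sound : CheapWithin (fromℕ N) N 0ℚ x y → DistLt R x y (fromℕ N)
        sound cheap with cheapWithin⇒walk (fromℕ N) N cheap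
        ... | c , w , 0+c<N = c , w , subst (ℚ._< fromℕ N) (ℚ.+-identityˡ c) 0+c<N

        complete : DistLt R x y (fromℕ N) → CheapWithin (fromℕ N) N 0ℚ x y
        complete (c , w , c<N) with shortcut w
        ... | c′ , w′ , c′≤c , hops≤c′ =
          walk⇒cheapWithin (fromℕ N) w′ hops<N (subst (ℚ._< fromℕ N) (sym (ℚ.+-identityˡ c′)) c′<N)
          where
          c′<N = ℚ.≤-<-trans c′≤c c<N
          hops<N = fromℕ-cancel-< (ℚ.≤-<-trans hops≤c′ c′<N)

      active? : ∀ i x → Dec (Active R i x)
      active? i x = map′ witness reduce (∃? λ w → R? x w ×-dec (i ≤? level w))
        where
        witness : (∃ λ w → R x w × i ≤ level w) → Active R i x
        witness (w , rxw , i≤) = w , level w , rxw , level-isLevel w , i≤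
        reduce : Active R i x → ∃ λ w → R x w × i ≤ level w
        reduce (w , m , rxw , isLevel , i≤m) =
          w , rxw , subst (i ≤_) (ceilLog₂-unique isLevel (level-isLevel w)) i≤m

      adj? : ∀ i → Decidable (Adj R i)
      adj? i x y = active? i x ×-dec (active? i y ×-dec distLt? (2 ^ suc i) x y)

      next? : ∀ i → Decidable (Next R i)
      next? i x y = R? x y ⊎-dec (active? i x ×-dec (active? i y ×-dec star? (adj? i) x y))

    same-isPER : ∀ t i → IsPartialEquivalence (Same t i)
    same-isPER t zero    = record
      { sym   = λ { (arrived , refl) → arrived , refl }
      ; trans = λ { (arrived , refl) (_ , refl) → arrived , refl }
      }
    same-isPER t (suc i) = next-isPER (same-isPER t i) i

    same? : ∀ t i → Decidable (Same t i)
    same? t zero    x y = (toℕ (proj₁ x) <? t) ×-dec (x ≟ᵀ y)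
    same? t (suc i)     = next? (same? t i) (IsPartialEquivalence.trans (same-isPER t i)) i

    module Inheritance (s i : ℕ) (Fprev Finh : List Edge)
      (Fprev-forest : IsSpanningForest (Same s i) i (HEdge (Same s i) i) Fprev)
      (Finh-forest : IsSpanningForest (Same (suc s) i) i (InhEdge (suc s) i Fprev) Finh) where

      ConnInh : T → T → Set
      ConnInh = ConnE (Same (suc s) i) (InhEdge (suc s) i Fprev)

      forestEdge⇒connInh : ∀ {u v} → (u , v) ∈ Fprev → ConnInh u v
      forestEdge⇒connInh {u} {v} uv∈F
        with same? (suc s) i u v | IsSpanningForest.edges Fprev-forest (u , v) uv∈F
      ... | yes same′ | _ = return (inj₁ same′)
      ... | no ¬same′ | au , av , _ =
        return (inj₂ (inj₁ ((u , v) , uv∈F , ¬same′ , inj₁ (same-refl i (arrived au) ,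
                                                           same-refl i (arrived av)))))
        where
        arrived : ∀ {x} → Active (Same s i) i x → Arr (suc s) x
        arrived (_ , _ , r , _) = ℕ.m<n⇒m<1+n (same-arrived i r)

      forestPath⇒connInh : ConnF (Same s i) Fprev ⇒ ConnInh
      forestPath⇒connInh = step ⋆
        where
        step : ∀ {a b} → Same s i a b ⊎ (a , b) ∈ Fprev ⊎ (b , a) ∈ Fprev → ConnInh a b
        step (inj₁ r)          = return (inj₁ (same-mono i r))
        step (inj₂ (inj₁ ab∈)) = forestEdge⇒connInh ab∈
        step (inj₂ (inj₂ ba∈)) =
          connE-sym (IsPartialEquivalence.sym (same-isPER (suc s) i)) (forestEdge⇒connInh ba∈)

      adj⇒connInh : Adj (Same s i) i ⇒ ConnInh
      adj⇒connInh {a} {b} (aa , ab , close) with same? s i a b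
      ... | yes r = return (inj₁ (same-mono i r))
      ... | no ¬r = forestPath⇒connInh (IsSpanningForest.spanning Fprev-forest a b aa ab
                                          (return (inj₂ (inj₁ (aa , ab , close , ¬r)))))

      merged⇒contracted : Same s (suc i) ⇒ Contract (Same (suc s) i) i Finh
      merged⇒contracted (inj₁ r) = inj₁ (same-mono i r)
      merged⇒contracted {x} {y} (inj₂ (ax , ay , path)) =
        inj₂ (ax′ , ay′ , IsSpanningForest.spanning Finh-forest x y ax′ ay′ ((adj⇒connInh ⋆) path))
        where
        ax′ : Active (Same (suc s) i) i x
        ax′ = active-mono {Same s i} (same-mono i) ax
        ay′ : Active (Same (suc s) i) i y
        ay′ = active-mono {Same s i} (same-mono i) ay

open Defs using (Edge; IsSpanningForest; HEdge; InhEdge; SameEdge; Same; Contract)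

lemma4p4 : (k : ℕ) (d : Term k → Term k → ℚ) → IsMetric k d →
    (F Finh : ℕ → ℕ → List (Edge k d)) →
    (∀ t i → t ≤ k → IsSpanningForest k d (Same k d t i) i (HEdge k d (Same k d t i) i) (F t i)) →
    (∀ s i → suc s ≤ k →
      IsSpanningForest k d (Same k d (suc s) i) i (InhEdge k d (suc s) i (F s i)) (Finh (suc s) i)) →
    (∀ s i → suc s ≤ k → ∀ e → e ∈ Finh (suc s) i →
      ∃ λ e′ → e′ ∈ F (suc s) i × SameEdge k d (Same k d (suc s) i) e e′) →
    ∀ s i → suc s ≤ k → ∀ x y →
      Same k d s (suc i) x y → Contract k d (Same k d (suc s) i) i (Finh (suc s) i) x y
lemma4p4 k d metric F Finh F-forest Finh-forest _ s i s<k x y =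
  Clustering.Inheritance.merged⇒contracted k d metric s i (F s i) (Finh (suc s) i)
    (F-forest s i (ℕ.<⇒≤ s<k)) (Finh-forest s i s<k)
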